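{- Let $\mathbb{K}$ be a field of characteristic $2$ and let $X^2+a_1X+a_2$ be an irreducible polynomial over $\mathbb{K}$ with $a_1\neq 0$. Let $\alpha$ be a root of it and $\mathbb{L}=\mathbb{K}(\alpha)$. Then for $\beta\in\mathbb{L}$: $\beta\in T_0T_0$ if and only if $\beta\in\mathbb{K}$.
   Context: $\mathrm{Tr}=\mathrm{Tr}_{\mathbb{L}/\mathbb{K}}$ is the field trace. $T_0=\{x\in\mathbb{L}\mid\mathrm{Tr}(x)=0\}$ and $T_0T_0=\{xy\mid x,y\in T_0\}$. -}

module Defs where

open import Level using (Level; _⊔_)
open import Algebra.Bundles using (CommutativeRing)
open import Data.Product using (_×_; _,_; proj₁; proj₂; ∃; ∃₂)
open import Relation.Nullary using (¬_)

record IsField {c ℓ : Level} (R : CommutativeRing c ℓ) : Set (c ⊔ ℓ) where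
  open CommutativeRing R
  field
    1≉0 : ¬ (1# ≈ 0#)
    inverse : ∀ x → ¬ (x ≈ 0#) → ∃ λ y → x * y ≈ 1#

module _ {c ℓ : Level} (R : CommutativeRing c ℓ) where
  open CommutativeRing R

  Char2 : Set ℓ
  Char2 = 1# + 1# ≈ 0#

  -- X² + a₁X + a₂ is irreducible over K: it is not a product (X + b)(X + c)
  -- of two monic linear polynomials (any factorization of a monic quadratic
  -- into non-units is, after normalising leading coefficients, of this form).
  Irreducible : Carrier → Carrier → Set (c ⊔ ℓ)
  Irreducible a₁ a₂ = ∀ b c → ¬ ((b + c ≈ a₁) × (b * c ≈ a₂))

-- L = K(α) = K[X]/(X² + a₁X + a₂), with elements x + yα represented as pairs (x , y)
-- and α² = - a₁ α - a₂.
module Quadratic {c ℓ : Level} (R : CommutativeRing c ℓ) (a₁ a₂ : CommutativeRing.Carrier R) where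
  open CommutativeRing R

  L : Set c
  L = Carrier × Carrier

  _≈L_ : L → L → Set ℓ
  (x , y) ≈L (x' , y') = (x ≈ x') × (y ≈ y')

  -- (x + yα)(x' + y'α) = x x' + (x y' + y x') α + y y' α²
  _·_ : L → L → L
  (x , y) · (x' , y') = (x * x' - y * y' * a₂ , (x * y' + y * x') - y * y' * a₁)

  oneL : L
  oneL = (1# , 0#)

  α : L
  α = (0# , 1#)

  ι : Carrier → L
  ι k = (k , 0#)

  -- Field trace Tr_{L/K}: the trace of the K-linear map (multiplication by β)
  -- with respect to the K-basis (1 , α): sum of diagonal entries of its matrix.
  Tr : L → Carrier
  Tr β = proj₁ (β · oneL) + proj₂ (β · α)

  T₀ : L → Set ℓ
  T₀ x = Tr x ≈ 0#

  InT₀T₀ : L → Set (c ⊔ ℓ)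
  InT₀T₀ β = ∃₂ λ x y → T₀ x × T₀ y × (β ≈L (x · y))

  InK : L → Set (c ⊔ ℓ)
  InK β = ∃ λ k → β ≈L ι k

{-# OPTIONS --safe #-}
module Submission where

-- In characteristic 2 the trace of x + yα is 2x - a₁y = a₁y, so, a₁ being
-- invertible, T₀ is exactly K. Hence T₀T₀ = K K = K.

open import Defs
open import Level using (Level)
open import Algebra.Bundles using (CommutativeRing)
open import Relation.Nullary using (¬_)
open import Function.Bundles using (_⇔_; mk⇔)
open import Data.Product using (_,_; proj₁)
import Algebra.Properties.Ring as RingProperties
import Relation.Binary.Reasoning.Setoid as SetoidReasoning

module CommutativeRingLemmas {c ℓ : Level} (R : CommutativeRing c ℓ) where
  open CommutativeRing R
  open RingProperties ring using (-0#≈0#; +-inverseʳ-unique)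
  open SetoidReasoning setoid

  x-0#≈x : ∀ x → x - 0# ≈ x
  x-0#≈x x = trans (+-congˡ -0#≈0#) (+-identityʳ x)

  x*0#*y≈0# : ∀ x y → x * 0# * y ≈ 0#
  x*0#*y≈0# x y = trans (*-congʳ (zeroʳ x)) (zeroˡ y)

  char2⇒x+x≈0# : Char2 R → ∀ x → x + x ≈ 0#
  char2⇒x+x≈0# char2 x = begin
    x + x             ≈⟨ +-cong (*-identityʳ x) (*-identityʳ x) ⟨
    x * 1# + x * 1#   ≈⟨ distribˡ x 1# 1# ⟨
    x * (1# + 1#)     ≈⟨ *-congˡ char2 ⟩
    x * 0#            ≈⟨ zeroʳ x ⟩
    0#                ∎

  char2⇒-x≈x : Char2 R → ∀ x → - x ≈ x
  char2⇒-x≈x char2 x = sym (+-inverseʳ-unique x x (char2⇒x+x≈0# char2 x))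

  module _ (field′ : IsField R) where

    x*y≈0#⇒x≈0# : ∀ {x y} → ¬ (y ≈ 0#) → x * y ≈ 0# → x ≈ 0#
    x*y≈0#⇒x≈0# {x} {y} y≉0 xy≈0 with IsField.inverse field′ y y≉0
    ... | y⁻¹ , yy⁻¹≈1 = begin
      x              ≈⟨ *-identityʳ x ⟨
      x * 1#         ≈⟨ *-congˡ yy⁻¹≈1 ⟨
      x * (y * y⁻¹)  ≈⟨ *-assoc x y y⁻¹ ⟨
      x * y * y⁻¹    ≈⟨ *-congʳ xy≈0 ⟩
      0# * y⁻¹       ≈⟨ zeroˡ y⁻¹ ⟩
      0#             ∎

module QuadraticLemmas {c ℓ : Level} (K : CommutativeRing c ℓ) (a₁ a₂ : CommutativeRing.Carrier K) where
  open CommutativeRing K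
  open Quadratic K a₁ a₂
  open CommutativeRingLemmas K
  open SetoidReasoning setoid

  ·-identityʳ : ∀ β → (β · oneL) ≈L β
  ·-identityʳ (x , y) = 1-coefficient , α-coefficient
    where
    1-coefficient : x * 1# - y * 0# * a₂ ≈ x
    1-coefficient = trans (+-cong (*-identityʳ x) (-‿cong (x*0#*y≈0# y a₂))) (x-0#≈x x)
    α-coefficient : (x * 0# + y * 1#) - y * 0# * a₁ ≈ y
    α-coefficient = trans (+-cong (trans (+-cong (zeroʳ x) (*-identityʳ y)) (+-identityˡ y))
                                  (-‿cong (x*0#*y≈0# y a₁)))
                          (x-0#≈x y)

  Tr[x+yα]≈x+x-y*a₁ : ∀ x y → Tr (x , y) ≈ (x + x) - y * a₁
  Tr[x+yα]≈x+x-y*a₁ x y = begin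
    Tr (x , y)        ≈⟨ +-cong (proj₁ (·-identityʳ (x , y))) α-coefficient ⟩
    x + (x - y * a₁)  ≈⟨ +-assoc x x _ ⟨
    (x + x) - y * a₁  ∎
    where
    α-coefficient : (x * 1# + y * 0#) - y * 1# * a₁ ≈ x - y * a₁
    α-coefficient = +-cong (trans (+-cong (*-identityʳ x) (zeroʳ y)) (+-identityʳ x))
                           (-‿cong (*-congʳ (*-identityʳ y)))

  char2⇒Tr[x+yα]≈y*a₁ : Char2 K → ∀ x y → Tr (x , y) ≈ y * a₁
  char2⇒Tr[x+yα]≈y*a₁ char2 x y = begin
    Tr (x , y)        ≈⟨ Tr[x+yα]≈x+x-y*a₁ x y ⟩
    (x + x) - y * a₁  ≈⟨ +-congʳ (char2⇒x+x≈0# char2 x) ⟩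
    0# - y * a₁       ≈⟨ +-identityˡ _ ⟩
    - (y * a₁)        ≈⟨ char2⇒-x≈x char2 _ ⟩
    y * a₁            ∎

  char2⇒T₀-ι : Char2 K → ∀ k → T₀ (ι k)
  char2⇒T₀-ι char2 k = trans (char2⇒Tr[x+yα]≈y*a₁ char2 k 0#) (zeroˡ a₁)

  T₀⇒InK : IsField K → Char2 K → ¬ (a₁ ≈ 0#) → ∀ β → T₀ β → InK β
  T₀⇒InK field′ char2 a₁≉0 (x , y) Trβ≈0 =
    x , refl , x*y≈0#⇒x≈0# field′ a₁≉0 (trans (sym (char2⇒Tr[x+yα]≈y*a₁ char2 x y)) Trβ≈0)

  InK-·-closed : ∀ β γ → InK β → InK γ → InK (β · γ)
  InK-·-closed (x , y) (x' , y') (_ , _ , y≈0) (_ , _ , y'≈0) = _ , refl , (begin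
    (x * y' + y * x') - y * y' * a₁  ≈⟨ +-cong (+-cong (*-congˡ y'≈0) (*-congʳ y≈0))
                                               (-‿cong (*-congʳ (*-congˡ y'≈0))) ⟩
    (x * 0# + 0# * x') - y * 0# * a₁ ≈⟨ +-cong (+-cong (zeroʳ x) (zeroˡ x')) (-‿cong (x*0#*y≈0# y a₁)) ⟩
    (0# + 0#) - 0#                   ≈⟨ x-0#≈x _ ⟩
    0# + 0#                          ≈⟨ +-identityʳ 0# ⟩
    0#                               ∎)

  InK-resp-≈L : ∀ {β γ} → β ≈L γ → InK γ → InK β
  InK-resp-≈L (β₁≈γ₁ , β₂≈γ₂) (k , γ₁≈k , γ₂≈0) = k , trans β₁≈γ₁ γ₁≈k , trans β₂≈γ₂ γ₂≈0

  InK⇒InT₀T₀ : Char2 K → ∀ β → InK β → InT₀T₀ β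
  InK⇒InT₀T₀ char2 (b₁ , b₂) (k , b₁≈k , b₂≈0) with ·-identityʳ (ι k)
  ... | k·1≈k , 0·1≈0 = ι k , oneL , char2⇒T₀-ι char2 k , char2⇒T₀-ι char2 1# ,
                         trans b₁≈k (sym k·1≈k) , trans b₂≈0 (sym 0·1≈0)

proposition2p5 : {c ℓ : Level} (K : CommutativeRing c ℓ) → IsField K → Char2 K →
    (a₁ a₂ : CommutativeRing.Carrier K) → Irreducible K a₁ a₂ →
    ¬ (CommutativeRing._≈_ K a₁ (CommutativeRing.0# K)) →
    (β : Quadratic.L K a₁ a₂) →
    Quadratic.InT₀T₀ K a₁ a₂ β ⇔ Quadratic.InK K a₁ a₂ β
-- Irreducibility only makes L a field; T₀T₀ = K holds without it.
proposition2p5 K field′ char2 a₁ a₂ _ a₁≉0 β = mk⇔ T₀T₀⊆K (InK⇒InT₀T₀ char2 β)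
  where
  open QuadraticLemmas K a₁ a₂
  open Quadratic K a₁ a₂ using (InT₀T₀; InK)
  T₀T₀⊆K : InT₀T₀ β → InK β
  T₀T₀⊆K (x , y , x∈T₀ , y∈T₀ , β≈xy) = InK-resp-≈L β≈xy
    (InK-·-closed x y (T₀⇒InK field′ char2 a₁≉0 x x∈T₀) (T₀⇒InK field′ char2 a₁≉0 y y∈T₀))
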